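{- Let $\Gamma=(V,E)$ be a simple graph of order $n$, size $m$ and maximum degree $\Delta$. Then the global offensive alliance number of $\Gamma$ satisfies $$\gamma_{a_o}(\Gamma)\ge \left\lceil\frac{(2n+\Delta+1)-\sqrt{(2n+\Delta+1)^2-8(2m+n)}}{4}\right\rceil,$$ and the global strong offensive alliance number of $\Gamma$ satisfies $$\gamma_{\hat a_o}(\Gamma)\ge \left\lceil\frac{(2n+\Delta+2)-\sqrt{(2n+\Delta+2)^2-16(m+n)}}{4}\right\rceil.$$
   Context: For $S\subseteq V$ and $v\in V$, let $N_S(v)=\{u\in S: u\sim v\}$ and $N_{V\setminus S}(v)=\{u\in V\setminus S: u\sim v\}$. A nonempty set $S\subseteq V$ is a global offensive alliance if $|N_S(v)|\ge |N_{V\setminus S}(v)|+1$ for every $v\in V\setminus S$, and a global strong offensive alliance if $|N_S(v)|\ge |N_{V\setminus S}(v)|+2$ for every $v\in V\setminus S$. $\gamma_{a_o}(\Gamma)$ (resp. $\gamma_{\hat a_o}(\Gamma)$) is the minimum cardinality of a global offensive (resp. global strong offensive) alliance. -}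

module Defs where

open import Data.Nat using (ℕ; zero; suc; _+_; _*_; _∸_; _≤_; _⊔_; _<ᵇ_)
open import Data.Bool using (Bool; true; false; if_then_else_; _∧_; not)
open import Data.Fin using (Fin; zero; suc; toℕ)
open import Data.Fin.Subset using (Subset; Nonempty; ∣_∣)
open import Data.Vec using (lookup)
open import Data.Product using (_×_)
open import Data.Sum using (_⊎_)
open import Relation.Binary.PropositionalEquality using (_≡_)

cnt : ∀ {n} → (Fin n → Bool) → ℕ
cnt {zero}  f = 0
cnt {suc n} f = (if f zero then 1 else 0) + cnt (λ i → f (suc i))

sumFin : ∀ {n} → (Fin n → ℕ) → ℕ
sumFin {zero}  f = 0
sumFin {suc n} f = f zero + sumFin (λ i → f (suc i))

maxFin : ∀ {n} → (Fin n → ℕ) → ℕ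
maxFin {zero}  f = 0
maxFin {suc n} f = f zero ⊔ maxFin (λ i → f (suc i))

record Graph (n : ℕ) : Set where
  field
    adj    : Fin n → Fin n → Bool
    sym    : ∀ i j → adj i j ≡ adj j i
    irrefl : ∀ i → adj i i ≡ false

open Graph public

degree : ∀ {n} → Graph n → Fin n → ℕ
degree G v = cnt (adj G v)

maxDegree : ∀ {n} → Graph n → ℕ
maxDegree G = maxFin (degree G)

size : ∀ {n} → Graph n → ℕ
size G = sumFin (λ i → cnt (λ j → (toℕ i <ᵇ toℕ j) ∧ adj G i j))

NS : ∀ {n} → Graph n → Subset n → Fin n → ℕ
NS G S v = cnt (λ u → lookup S u ∧ adj G u v)

NVS : ∀ {n} → Graph n → Subset n → Fin n → ℕ
NVS G S v = cnt (λ u → not (lookup S u) ∧ adj G u v)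

GlobalOffensiveAlliance : ∀ {n} → Graph n → Subset n → Set
GlobalOffensiveAlliance G S =
  Nonempty S × (∀ v → lookup S v ≡ false → NVS G S v + 1 ≤ NS G S v)

GlobalStrongOffensiveAlliance : ∀ {n} → Graph n → Subset n → Set
GlobalStrongOffensiveAlliance G S =
  Nonempty S × (∀ v → lookup S v ≡ false → NVS G S v + 2 ≤ NS G S v)

-- k ≥ ⌈(B - √(B² - C)) / 4⌉  (for natural k, assuming C ≤ B²), i.e.
-- 4k ≥ B - √(B² - C), written without square roots:
-- either B ≤ 4k, or (B - 4k)² ≤ B² - C, i.e. (B - 4k)² + C ≤ B².
AtLeastCeilRootBound : ℕ → ℕ → ℕ → Set
AtLeastCeilRootBound k B C =
  (B ≤ 4 * k) ⊎ ((B ∸ 4 * k) * (B ∸ 4 * k) + C ≤ B * B)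

{-# OPTIONS --safe #-}
-- Let k = |S| and j = n - k. Every vertex outside an alliance S satisfying
-- |N_S(v)| ≥ |N_{V∖S}(v)| + c has degree at most 2k - c, and every vertex of S has degree
-- at most Δ, so the handshake lemma gives 2m + cj ≤ kΔ + 2kj. Substituting j = n - k turns
-- this into the quadratic inequality (4k)² - 2(4k)(2n + Δ + c) + 8(2m + cn) ≤ 0, whose
-- smaller root is the bound; c = 1 and c = 2 give the two statements.
module Submission where

open import Defs
open import Data.Nat using (ℕ; zero; suc; _+_; _*_; _∸_; _≤_; _<ᵇ_; _≤?_; z≤n)
open import Data.Fin.Subset using (Subset; ∣_∣)
open import Data.Nat.Properties
open import Data.Nat.Tactic.RingSolver using (solve-∀)
open import Algebra.Properties.Semiring.Sum +-*-semiring
  using (sum; sum-syntax; sum-cong-≗; ∑-distrib-+; ∑-comm)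
open import Algebra.Properties.CommutativeSemigroup +-commutativeSemigroup
  using (x∙yz≈y∙xz)
open import Data.Bool using (Bool; true; false; T; if_then_else_; _∧_; not)
open import Data.Bool.Properties using (T-∧)
open import Data.Empty using (⊥-elim)
open import Data.Fin using (Fin; zero; suc; toℕ)
open import Data.Vec using ([]; _∷_; lookup)
open import Data.Product using (_×_; _,_; proj₁; proj₂; map₁)
open import Data.Sum using (_⊎_; inj₁; inj₂)
open import Data.Unit using (tt)
open import Function using (_∘_; Equivalence)
open import Relation.Nullary using (yes; no)
open import Relation.Binary.PropositionalEquality as ≡
  using (_≡_; refl; cong; cong₂; subst; subst₂; module ≡-Reasoning)

𝟙 : Bool → ℕ
𝟙 b = if b then 1 else 0

𝟙-mono : ∀ {a b} → (T a → T b) → 𝟙 a ≤ 𝟙 b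
𝟙-mono {false}         _   = z≤n
𝟙-mono {true}  {true}  _   = ≤-refl
𝟙-mono {true}  {false} a⇒b = ⊥-elim (a⇒b tt)

𝟙-∧-split : ∀ a b → 𝟙 (a ∧ b) + 𝟙 (not a ∧ b) ≡ 𝟙 b
𝟙-∧-split true  b = +-identityʳ (𝟙 b)
𝟙-∧-split false b = refl

sum-mono-≤ : ∀ {n} {f g : Fin n → ℕ} → (∀ i → f i ≤ g i) → sum f ≤ sum g
sum-mono-≤ {zero}  _   = z≤n
sum-mono-≤ {suc n} f≤g = +-mono-≤ (f≤g zero) (sum-mono-≤ (f≤g ∘ suc))

sumFin≡sum : ∀ {n} (f : Fin n → ℕ) → sumFin f ≡ sum f
sumFin≡sum {zero}  f = refl
sumFin≡sum {suc n} f = cong (f zero +_) (sumFin≡sum (f ∘ suc))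

≤maxFin : ∀ {n} (f : Fin n → ℕ) i → f i ≤ maxFin f
≤maxFin f zero    = m≤m⊔n _ _
≤maxFin f (suc i) = ≤-trans (≤maxFin (f ∘ suc) i) (m≤n⊔m _ _)

cnt≡∑𝟙 : ∀ {n} (p : Fin n → Bool) → cnt p ≡ ∑[ i < n ] 𝟙 (p i)
cnt≡∑𝟙 {zero}  p = refl
cnt≡∑𝟙 {suc n} p = cong (𝟙 (p zero) +_) (cnt≡∑𝟙 (p ∘ suc))

cnt-cong : ∀ {n} {p q : Fin n → Bool} → (∀ i → p i ≡ q i) → cnt p ≡ cnt q
cnt-cong {zero}  _   = refl
cnt-cong {suc n} p≗q = cong₂ _+_ (cong 𝟙 (p≗q zero)) (cnt-cong (p≗q ∘ suc))

cnt-mono : ∀ {n} {p q : Fin n → Bool} → (∀ i → T (p i) → T (q i)) → cnt p ≤ cnt q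
cnt-mono {zero}  _   = z≤n
cnt-mono {suc n} p⇒q = +-mono-≤ (𝟙-mono (p⇒q zero)) (cnt-mono (p⇒q ∘ suc))

cnt-∧-≤ : ∀ {n} (p q : Fin n → Bool) → cnt (λ i → p i ∧ q i) ≤ cnt p
cnt-∧-≤ p q = cnt-mono (λ i → proj₁ ∘ Equivalence.to (T-∧ {p i}))

cnt-∧-split : ∀ {n} (p q : Fin n → Bool) →
  cnt (λ i → p i ∧ q i) + cnt (λ i → not (p i) ∧ q i) ≡ cnt q
cnt-∧-split {n} p q = begin
  cnt (λ i → p i ∧ q i) + cnt (λ i → not (p i) ∧ q i)
    ≡⟨ cong₂ _+_ (cnt≡∑𝟙 (λ i → p i ∧ q i)) (cnt≡∑𝟙 (λ i → not (p i) ∧ q i)) ⟩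
  ∑[ i < n ] 𝟙 (p i ∧ q i) + ∑[ i < n ] 𝟙 (not (p i) ∧ q i)
    ≡⟨ ≡.sym (∑-distrib-+ (λ i → 𝟙 (p i ∧ q i)) (λ i → 𝟙 (not (p i) ∧ q i))) ⟩
  ∑[ i < n ] (𝟙 (p i ∧ q i) + 𝟙 (not (p i) ∧ q i))
    ≡⟨ sum-cong-≗ (λ i → 𝟙-∧-split (p i) (q i)) ⟩
  ∑[ i < n ] 𝟙 (q i)
    ≡⟨ ≡.sym (cnt≡∑𝟙 q) ⟩
  cnt q ∎
  where open ≡-Reasoning

cnt+cnt-not : ∀ {n} (p : Fin n → Bool) → cnt p + cnt (not ∘ p) ≡ n
cnt+cnt-not {zero}  p = refl
cnt+cnt-not {suc n} p with p zero
... | true  = cong suc (cnt+cnt-not (p ∘ suc))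
... | false = ≡.trans (+-suc _ _) (cong suc (cnt+cnt-not (p ∘ suc)))

∑-if : ∀ {n} (p : Fin n → Bool) (a b : ℕ) →
  ∑[ i < n ] (if p i then a else b) ≡ cnt p * a + cnt (not ∘ p) * b
∑-if {zero}  p a b = refl
∑-if {suc n} p a b with p zero
... | true  = ≡.trans (cong (a +_) (∑-if (p ∘ suc) a b))
                    (≡.sym (+-assoc a (cnt (p ∘ suc) * a) (cnt (not ∘ p ∘ suc) * b)))
... | false = ≡.trans (cong (b +_) (∑-if (p ∘ suc) a b))
                    (x∙yz≈y∙xz b (cnt (p ∘ suc) * a) (cnt (not ∘ p ∘ suc) * b))

∣p∣≡cnt : ∀ {n} (p : Subset n) → ∣ p ∣ ≡ cnt (lookup p)
∣p∣≡cnt []          = refl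
∣p∣≡cnt (true  ∷ p) = cong suc (∣p∣≡cnt p)
∣p∣≡cnt (false ∷ p) = ∣p∣≡cnt p

<ᵇ-asym : ∀ m n → T (n <ᵇ m) → T (not (m <ᵇ n))
<ᵇ-asym (suc m) zero    _ = tt
<ᵇ-asym (suc m) (suc n)   = <ᵇ-asym m n

-- The smaller root of x² - 2Bx + C is B - √(B² - C).
x²+C≤2xB⇒smallerRoot≤x : ∀ x B C → x * x + C ≤ 2 * x * B →
  B ≤ x ⊎ (B ∸ x) * (B ∸ x) + C ≤ B * B
x²+C≤2xB⇒smallerRoot≤x x B C x²+C≤2xB with B ≤? x
... | yes B≤x = inj₁ B≤x
... | no  B≰x = inj₂ (+-cancelʳ-≤ (x * x) _ _ (begin
  d * d + C + x * x     ≡⟨ shuffle d x C ⟩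
  d * d + (x * x + C)   ≤⟨ +-monoʳ-≤ (d * d) x²+C≤2xB ⟩
  d * d + 2 * x * B     ≡⟨ cong (λ b → d * d + 2 * x * b) (≡.sym d+x≡B) ⟩
  d * d + 2 * x * (d + x) ≡⟨ square d x ⟩
  (d + x) * (d + x) + x * x ≡⟨ cong (λ b → b * b + x * x) d+x≡B ⟩
  B * B + x * x         ∎))
  where
  open ≤-Reasoning
  d = B ∸ x
  d+x≡B : d + x ≡ B
  d+x≡B = m∸n+n≡m (<⇒≤ (≰⇒> B≰x))
  shuffle : ∀ d x C → d * d + C + x * x ≡ d * d + (x * x + C)
  shuffle = solve-∀
  square : ∀ d x → d * d + 2 * x * (d + x) ≡ (d + x) * (d + x) + x * x
  square = solve-∀

2m+jc≤kΔ+2jk⇒quadratic : ∀ k j m Δ c → 2 * m + j * c ≤ k * Δ + j * (2 * k) →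
  4 * k * (4 * k) + 8 * (2 * m + c * (k + j)) ≤ 2 * (4 * k) * (2 * (k + j) + Δ + c)
2m+jc≤kΔ+2jk⇒quadratic k j m Δ c ineq = begin
  4 * k * (4 * k) + 8 * (2 * m + c * (k + j))     ≡⟨ lhs k j m c ⟩
  4 * k * (4 * k) + 8 * (c * k) + 8 * (2 * m + j * c)
    ≤⟨ +-monoʳ-≤ (4 * k * (4 * k) + 8 * (c * k)) (*-monoʳ-≤ 8 ineq) ⟩
  4 * k * (4 * k) + 8 * (c * k) + 8 * (k * Δ + j * (2 * k)) ≡⟨ rhs k j Δ c ⟩
  2 * (4 * k) * (2 * (k + j) + Δ + c)             ∎
  where
  open ≤-Reasoning
  lhs : ∀ k j m c → 4 * k * (4 * k) + 8 * (2 * m + c * (k + j))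
                  ≡ 4 * k * (4 * k) + 8 * (c * k) + 8 * (2 * m + j * c)
  lhs = solve-∀
  rhs : ∀ k j Δ c → 4 * k * (4 * k) + 8 * (c * k) + 8 * (k * Δ + j * (2 * k))
                  ≡ 2 * (4 * k) * (2 * (k + j) + Δ + c)
  rhs = solve-∀

module _ {n : ℕ} (G : Graph n) where

  -- size counts each edge at its smaller endpoint; counting it also at the larger one
  -- yields the handshake inequality.
  upperDegree lowerDegree : Fin n → ℕ
  upperDegree i = cnt (λ j → (toℕ i <ᵇ toℕ j) ∧ adj G i j)
  lowerDegree i = cnt (λ j → (toℕ j <ᵇ toℕ i) ∧ adj G i j)

  size≡∑lowerDegree : size G ≡ ∑[ i < n ] lowerDegree i
  size≡∑lowerDegree = begin
    size G
      ≡⟨ sumFin≡sum upperDegree ⟩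
    ∑[ i < n ] upperDegree i
      ≡⟨ sum-cong-≗ (λ i → cnt≡∑𝟙 (λ j → (toℕ i <ᵇ toℕ j) ∧ adj G i j)) ⟩
    ∑[ i < n ] ∑[ j < n ] 𝟙 ((toℕ i <ᵇ toℕ j) ∧ adj G i j)
      ≡⟨ ∑-comm (λ i j → 𝟙 ((toℕ i <ᵇ toℕ j) ∧ adj G i j)) ⟩
    ∑[ j < n ] ∑[ i < n ] 𝟙 ((toℕ i <ᵇ toℕ j) ∧ adj G i j)
      ≡⟨ sum-cong-≗ (λ j → sum-cong-≗ (λ i → cong (𝟙 ∘ ((toℕ i <ᵇ toℕ j) ∧_)) (sym G i j))) ⟩
    ∑[ j < n ] ∑[ i < n ] 𝟙 ((toℕ i <ᵇ toℕ j) ∧ adj G j i)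
      ≡⟨ ≡.sym (sum-cong-≗ (λ j → cnt≡∑𝟙 (λ i → (toℕ i <ᵇ toℕ j) ∧ adj G j i))) ⟩
    ∑[ j < n ] lowerDegree j ∎
    where open ≡-Reasoning

  upperDegree+lowerDegree≤degree : ∀ i → upperDegree i + lowerDegree i ≤ degree G i
  upperDegree+lowerDegree≤degree i = begin
    upperDegree i + lowerDegree i
      ≤⟨ +-monoʳ-≤ (upperDegree i) (cnt-mono lower⇒notUpper) ⟩
    upperDegree i + cnt (λ j → not (toℕ i <ᵇ toℕ j) ∧ adj G i j)
      ≡⟨ cnt-∧-split (λ j → toℕ i <ᵇ toℕ j) (adj G i) ⟩
    degree G i ∎
    where
    open ≤-Reasoning
    lower⇒notUpper : ∀ j → T ((toℕ j <ᵇ toℕ i) ∧ adj G i j) → T (not (toℕ i <ᵇ toℕ j) ∧ adj G i j)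
    lower⇒notUpper j = Equivalence.from T-∧ ∘ map₁ (<ᵇ-asym (toℕ i) (toℕ j)) ∘ Equivalence.to T-∧

  2*size≤∑degree : 2 * size G ≤ ∑[ i < n ] degree G i
  2*size≤∑degree = begin
    2 * size G
      ≡⟨ cong (size G +_) (+-identityʳ (size G)) ⟩
    size G + size G
      ≡⟨ cong₂ _+_ (sumFin≡sum upperDegree) size≡∑lowerDegree ⟩
    ∑[ i < n ] upperDegree i + ∑[ i < n ] lowerDegree i
      ≡⟨ ≡.sym (∑-distrib-+ upperDegree lowerDegree) ⟩
    ∑[ i < n ] (upperDegree i + lowerDegree i)
      ≤⟨ sum-mono-≤ upperDegree+lowerDegree≤degree ⟩
    ∑[ i < n ] degree G i ∎
    where open ≤-Reasoning

  degree≡NS+NVS : ∀ S v → degree G v ≡ NS G S v + NVS G S v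
  degree≡NS+NVS S v = ≡.trans (cnt-cong (sym G v)) (≡.sym (cnt-∧-split (lookup S) (λ u → adj G u v)))

  Offensive : ℕ → Subset n → Set
  Offensive c S = ∀ v → lookup S v ≡ false → NVS G S v + c ≤ NS G S v

  offensive⇒2*size+slack≤ : ∀ c S → Offensive c S →
    let k = cnt (lookup S); j = cnt (not ∘ lookup S)
    in 2 * size G + j * c ≤ k * maxDegree G + j * (2 * k)
  offensive⇒2*size+slack≤ c S offensive = begin
    2 * size G + j * c
      ≤⟨ +-monoˡ-≤ (j * c) 2*size≤∑degree ⟩
    ∑[ v < n ] degree G v + j * c
      ≡⟨ cong (λ t → ∑[ v < n ] degree G v + (t + j * c)) (≡.sym (*-zeroʳ k)) ⟩
    ∑[ v < n ] degree G v + (k * 0 + j * c)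
      ≡⟨ cong (∑[ v < n ] degree G v +_) (≡.sym (∑-if (lookup S) 0 c)) ⟩
    ∑[ v < n ] degree G v + ∑[ v < n ] slack v
      ≡⟨ ≡.sym (∑-distrib-+ (degree G) slack) ⟩
    ∑[ v < n ] (degree G v + slack v)
      ≤⟨ sum-mono-≤ degree+slack≤bound ⟩
    ∑[ v < n ] (if lookup S v then maxDegree G else 2 * k)
      ≡⟨ ∑-if (lookup S) (maxDegree G) (2 * k) ⟩
    k * maxDegree G + j * (2 * k) ∎
    where
    open ≤-Reasoning
    k = cnt (lookup S)
    j = cnt (not ∘ lookup S)
    slack : Fin n → ℕ
    slack v = if lookup S v then 0 else c
    degree+slack≤bound : ∀ v → degree G v + slack v ≤ (if lookup S v then maxDegree G else 2 * k)
    degree+slack≤bound v with lookup S v in v∉S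
    ... | true  = ≤-trans (≤-reflexive (+-identityʳ (degree G v))) (≤maxFin (degree G) v)
    ... | false = begin
      degree G v + c                  ≡⟨ cong (_+ c) (degree≡NS+NVS S v) ⟩
      NS G S v + NVS G S v + c        ≡⟨ +-assoc (NS G S v) (NVS G S v) c ⟩
      NS G S v + (NVS G S v + c)      ≤⟨ +-monoʳ-≤ (NS G S v) (offensive v v∉S) ⟩
      NS G S v + NS G S v             ≤⟨ +-mono-≤ NS≤k NS≤k ⟩
      k + k                           ≡⟨ cong (k +_) (≡.sym (+-identityʳ k)) ⟩
      2 * k                           ∎
      where
      NS≤k : NS G S v ≤ k
      NS≤k = cnt-∧-≤ (lookup S) (λ u → adj G u v)

  offensive⇒ceilRootBound : ∀ c S → Offensive c S →
    AtLeastCeilRootBound ∣ S ∣ (2 * n + maxDegree G + c) (8 * (2 * size G + c * n))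
  offensive⇒ceilRootBound c S offensive =
    subst₂ (λ k n → AtLeastCeilRootBound k (2 * n + maxDegree G + c) (8 * (2 * size G + c * n)))
      (≡.sym (∣p∣≡cnt S)) (cnt+cnt-not (lookup S))
      (x²+C≤2xB⇒smallerRoot≤x (4 * k) _ _
        (2m+jc≤kΔ+2jk⇒quadratic k (cnt (not ∘ lookup S)) (size G) (maxDegree G) c
          (offensive⇒2*size+slack≤ c S offensive)))
    where
    k = cnt (lookup S)

theorem7 : ∀ {n : ℕ} (G : Graph n) →
    ((S : Subset n) → GlobalOffensiveAlliance G S →
      AtLeastCeilRootBound ∣ S ∣ (2 * n + maxDegree G + 1) (8 * (2 * size G + n)))
    × ((S : Subset n) → GlobalStrongOffensiveAlliance G S →
      AtLeastCeilRootBound ∣ S ∣ (2 * n + maxDegree G + 2) (16 * (size G + n)))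
theorem7 {n} G =
    (λ S alliance → subst (AtLeastCeilRootBound ∣ S ∣ _) 8*[2m+1*n]≡8*[2m+n]
                      (offensive⇒ceilRootBound G 1 S (proj₂ alliance)))
  , (λ S alliance → subst (AtLeastCeilRootBound ∣ S ∣ _) 8*[2m+2*n]≡16*[m+n]
                      (offensive⇒ceilRootBound G 2 S (proj₂ alliance)))
  where
  8*[2m+1*n]≡8*[2m+n] : 8 * (2 * size G + 1 * n) ≡ 8 * (2 * size G + n)
  8*[2m+1*n]≡8*[2m+n] = cong (λ t → 8 * (2 * size G + t)) (*-identityˡ n)
  8*[2m+2*n]≡16*[m+n] : 8 * (2 * size G + 2 * n) ≡ 16 * (size G + n)
  8*[2m+2*n]≡16*[m+n] =
    ≡.trans (cong (8 *_) (≡.sym (*-distribˡ-+ 2 (size G) n))) (≡.sym (*-assoc 8 2 (size G + n)))
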